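{- Let $D$ be a complete lattice satisfying condition $(\bigstar)$, and let $E$ be a complete lattice for which there exists a surjective complete lattice homomorphism $h:D\to E$ (preserving arbitrary joins and meets). Then $E$ also satisfies $(\bigstar)$. The same holds with $(\bigstar)^\partial$ in place of $(\bigstar)$.
   Context: For a complete lattice $C$, $J^\infty(C)$ denotes the set of completely join irreducible elements and $M^\infty(C)$ the set of completely meet irreducible elements. $(\bigstar)$ means: for every $p\in J^\infty(C)$ there is a finite set $M_p\subseteq M^\infty(C)$ with $C\setminus{\uparrow}p={\downarrow}M_p$. $(\bigstar)^\partial$ means: for every $m\in M^\infty(C)$ there is a finite set $J_m\subseteq J^\infty(C)$ with $C\setminus{\downarrow}m={\uparrow}J_m$. -}

module Defs where

open import Level using (Level; _⊔_; suc)
open import Relation.Binary.Bundles using (Poset)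
open import Relation.Unary using (Pred; _∈_)
open import Data.Product using (Σ; _×_; ∃)
open import Data.List using (List)
open import Data.List.Relation.Unary.All using (All)
open import Data.List.Relation.Unary.Any using (Any)
open import Relation.Nullary using (¬_)

record CompleteLattice (c ℓ₁ ℓ₂ s : Level) : Set (suc (c ⊔ ℓ₁ ⊔ ℓ₂ ⊔ s)) where
  field
    poset : Poset c ℓ₁ ℓ₂
  open Poset poset public
  field
    ⋁     : Pred Carrier s → Carrier
    ⋁-ub  : ∀ (S : Pred Carrier s) {x} → x ∈ S → x ≤ ⋁ S
    ⋁-least : ∀ (S : Pred Carrier s) u → (∀ {x} → x ∈ S → x ≤ u) → ⋁ S ≤ u
    ⋀     : Pred Carrier s → Carrier
    ⋀-lb  : ∀ (S : Pred Carrier s) {x} → x ∈ S → ⋀ S ≤ x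
    ⋀-greatest : ∀ (S : Pred Carrier s) u → (∀ {x} → x ∈ S → u ≤ x) → u ≤ ⋀ S

module _ {c ℓ₁ ℓ₂ s} (C : CompleteLattice c ℓ₁ ℓ₂ s) where
  open CompleteLattice C

  CJI : Carrier → Set (c ⊔ ℓ₁ ⊔ suc s)
  CJI p = ∀ (S : Pred Carrier s) → p ≈ ⋁ S → ∃ λ q → q ∈ S × q ≈ p

  CMI : Carrier → Set (c ⊔ ℓ₁ ⊔ suc s)
  CMI m = ∀ (S : Pred Carrier s) → m ≈ ⋀ S → ∃ λ q → q ∈ S × q ≈ m

  -- (★): for every p ∈ J^∞(C) there is a finite M_p ⊆ M^∞(C) with
  -- C ∖ ↑p = ↓M_p, i.e. for all x: ¬ (p ≤ x) iff x ≤ m for some m ∈ M_p.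
  Star : Set (c ⊔ ℓ₁ ⊔ ℓ₂ ⊔ suc s)
  Star = ∀ p → CJI p → Σ (List Carrier) λ Mp → All CMI Mp ×
           (∀ x → ((¬ (p ≤ x)) → Any (λ m → x ≤ m) Mp) × (Any (λ m → x ≤ m) Mp → ¬ (p ≤ x)))

  -- (★)^∂: for every m ∈ M^∞(C) there is a finite J_m ⊆ J^∞(C) with
  -- C ∖ ↓m = ↑J_m.
  StarDual : Set (c ⊔ ℓ₁ ⊔ ℓ₂ ⊔ suc s)
  StarDual = ∀ m → CMI m → Σ (List Carrier) λ Jm → All CJI Jm ×
           (∀ x → ((¬ (x ≤ m)) → Any (λ j → j ≤ x) Jm) × (Any (λ j → j ≤ x) Jm → ¬ (x ≤ m)))

record IsCompleteHom {c₁ ℓ₁ ℓ₁' s₁ c₂ ℓ₂ ℓ₂' s₂}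
    (D : CompleteLattice c₁ ℓ₁ ℓ₁' s₁) (E : CompleteLattice c₂ ℓ₂ ℓ₂' s₂)
    (h : CompleteLattice.Carrier D → CompleteLattice.Carrier E)
    : Set (c₁ ⊔ ℓ₁ ⊔ suc s₁ ⊔ c₂ ⊔ ℓ₂ ⊔ ℓ₂') where
  private
    module D = CompleteLattice D
    module E = CompleteLattice E
  field
    cong : ∀ {x y} → x D.≈ y → h x E.≈ h y
    ⋁-ub : ∀ (S : Pred D.Carrier s₁) {x} → x ∈ S → h x E.≤ h (D.⋁ S)
    ⋁-least : ∀ (S : Pred D.Carrier s₁) u → (∀ {x} → x ∈ S → h x E.≤ u) → h (D.⋁ S) E.≤ u
    ⋀-lb : ∀ (S : Pred D.Carrier s₁) {x} → x ∈ S → h (D.⋀ S) E.≤ h x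
    ⋀-greatest : ∀ (S : Pred D.Carrier s₁) u → (∀ {x} → x ∈ S → u E.≤ h x) → u E.≤ h (D.⋀ S)

Surjective : ∀ {c₁ ℓ₁ ℓ₁' s₁ c₂ ℓ₂ ℓ₂' s₂}
    (D : CompleteLattice c₁ ℓ₁ ℓ₁' s₁) (E : CompleteLattice c₂ ℓ₂ ℓ₂' s₂)
    (h : CompleteLattice.Carrier D → CompleteLattice.Carrier E) → Set (c₁ ⊔ c₂ ⊔ ℓ₂)
Surjective D E h = ∀ y → ∃ λ x → CompleteLattice._≈_ E (h x) y

module Submission where

-- Since h preserves all
-- meets and joins it has a lower adjoint ℓ y = ⋀ {d ∣ y ≤ h d} and an upper
-- adjoint r y = ⋁ {d ∣ h d ≤ y}; surjectivity makes both sections of h,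
-- i.e. h (ℓ y) ≈ y ≈ h (r y).  Then ℓ maps J^∞(E) into J^∞(D), and h maps
-- every m ∈ M^∞(D) that is r∘h-closed (r (h m) ≤ m) into M^∞(E).
--
-- For p ∈ J^∞(E) take the finite set M for ℓ p given by (★) in D.  Since
-- p ≤ x ⇔ ℓ p ≤ r x, the image h[M] describes E ∖ ↑p, but its members need
-- not be completely meet irreducible.  A general pruning lemma on finite
-- families removes members of M dominated by other members until every
-- remaining member is r∘h-closed; the image of what is left is the required
-- set for p.  Finally (★)^∂ for C is (★) for the order dual of C, and h is
-- also a surjective complete homomorphism between the duals.

open import Defs
open import Level using (_⊔_)
open import Data.Nat using (ℕ; zero; suc)
open import Data.Fin using (Fin; punchIn; punchOut; _≟_)
open import Data.Fin.Properties using (punchIn-punchOut; ¬∀⟶∃¬; all?)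
open import Data.Product using (_×_; _,_; ∃; proj₁; proj₂)
open import Data.List using (List; length; lookup; tabulate)
open import Data.List.Relation.Unary.All as All using (All)
open import Data.List.Relation.Unary.Any as Any using (Any)
import Data.List.Relation.Unary.All.Properties as Allₚ
import Data.List.Relation.Unary.Any.Properties as Anyₚ
open import Data.List.Membership.Propositional.Properties using (∈-lookup)
open import Function using (_∘_)
open import Relation.Binary.Bundles using (Preorder)
open import Relation.Binary.PropositionalEquality using (_≡_; _≢_; refl; sym; subst)
open import Relation.Nullary using (¬_; Dec; yes; no)
open import Relation.Unary using (Pred)

ComplementOfUp : ∀ {c ℓ₁ ℓ₂ s} (C : CompleteLattice c ℓ₁ ℓ₂ s) →
  CompleteLattice.Carrier C → List (CompleteLattice.Carrier C) → Set (c ⊔ ℓ₂)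
ComplementOfUp C p M = ∀ x → (¬ (p ≤ x) → Any (λ m → x ≤ m) M) × (Any (λ m → x ≤ m) M → ¬ (p ≤ x))
  where open CompleteLattice C

-- A member m i with cl (m i) ≲ m j for
-- some j ≢ i is redundant and can be deleted without losing saturation, so
-- we recurse on the size of the family.
module Pruning {a ℓ₁ ℓ₂} (P : Preorder a ℓ₁ ℓ₂) where
  open Preorder P using (Carrier; _≲_) renaming (refl to ≲-refl; trans to ≲-trans)

  module _ (cl : Carrier → Carrier) (inflationary : ∀ x → x ≲ cl x) where

    Saturated : ∀ {k} → (Fin k → Carrier) → Set ℓ₂
    Saturated m = ∀ i → ∃ λ j → cl (m i) ≲ m j

    record Pruned {k} (m : Fin k → Carrier) : Set ℓ₂ where
      field
        size      : ℕ
        select    : Fin size → Fin k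
        closed    : ∀ j → cl (m (select j)) ≲ m (select j)
        dominates : ∀ i → ∃ λ j → m i ≲ m (select j)

    Redundant : ∀ {k} → (Fin (suc k) → Carrier) → Fin (suc k) → Set ℓ₂
    Redundant m i = ∀ t → ∃ λ u → m t ≲ m (punchIn i u)

    redundant : ∀ {k} (m : Fin (suc k) → Carrier) (i j : Fin (suc k)) →
      cl (m i) ≲ m j → i ≢ j → Redundant m i
    redundant m i j cli≲mj i≢j t with i ≟ t
    ... | yes refl = reindex i≢j (≲-trans (inflationary (m i)) cli≲mj)
      where
        reindex : ∀ {x s} (i≢s : i ≢ s) → x ≲ m s → ∃ λ u → x ≲ m (punchIn i u)
        reindex {x} i≢s x≲ms =
          punchOut i≢s , subst (λ s → x ≲ m s) (sym (punchIn-punchOut i≢s)) x≲ms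
    ... | no i≢t = punchOut i≢t , subst (λ s → m t ≲ m s) (sym (punchIn-punchOut i≢t)) ≲-refl

    saturatedWithout : ∀ {k} {m : Fin (suc k) → Carrier} {i} →
      Redundant m i → Saturated m → Saturated (m ∘ punchIn i)
    saturatedWithout {i = i} redundant-i saturated j =
      let (u , cl≲mu) = saturated (punchIn i j)
          (v , mu≲v) = redundant-i u
      in v , ≲-trans cl≲mu mu≲v

    prunedWithout : ∀ {k} {m : Fin (suc k) → Carrier} {i} →
      Redundant m i → Pruned (m ∘ punchIn i) → Pruned m
    prunedWithout {i = i} redundant-i pruned = record
      { size = size ; select = punchIn i ∘ select ; closed = closed
      ; dominates = λ t → let (u , t≲u) = redundant-i t
                              (j , u≲j) = dominates u
                          in j , ≲-trans t≲u u≲j }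
      where open Pruned pruned

    -- Either every member is below its own closure, or some member is redundant.
    prune : ∀ k (m : Fin k → Carrier) → Saturated m → Pruned m
    prune zero m _ = record { size = zero ; select = λ () ; closed = λ () ; dominates = λ () }
    prune (suc k) m saturated = decide (all? (λ i → redirect i ≟ i))
      where
        redirect : Fin (suc k) → Fin (suc k)
        redirect i = proj₁ (saturated i)
        decide : Dec (∀ i → redirect i ≡ i) → Pruned m
        decide (yes fixed) = record
          { size = suc k ; select = λ j → j
          ; closed = λ i → subst (λ j → cl (m i) ≲ m j) (fixed i) (proj₂ (saturated i))
          ; dominates = λ i → i , ≲-refl }
        decide (no notFixed) with ¬∀⟶∃¬ (suc k) _ (λ i → redirect i ≟ i) notFixed
        ... | i , moved =
          let redundant-i = redundant m i (redirect i) (proj₂ (saturated i)) (moved ∘ sym)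
          in prunedWithout redundant-i
               (prune k (m ∘ punchIn i) (saturatedWithout redundant-i saturated))

-- A single universe level c
-- lets the predicates defining ℓ, r and images of subsets live in D and E.
module SurjectiveHom {c} (D E : CompleteLattice c c c c)
  (h : CompleteLattice.Carrier D → CompleteLattice.Carrier E)
  (hom : IsCompleteHom D E h) (surjective : Surjective D E h) where
  private
    module D = CompleteLattice D
    module E = CompleteLattice E
    module H = IsCompleteHom hom
  open D using () renaming (_≤_ to _≤D_; _≈_ to _≈D_)
  open E using () renaming (_≤_ to _≤E_; _≈_ to _≈E_)

  -- Preservation of the meet of the principal filter ↑x makes h monotone.
  monotone : ∀ {x y} → x ≤D y → h x ≤E h y
  monotone {x} x≤y = E.trans (E.reflexive (H.cong (D.Eq.sym ⋀↑x≈x))) (H.⋀-lb ↑x x≤y)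
    where
      ↑x : Pred D.Carrier c
      ↑x z = x ≤D z
      ⋀↑x≈x : D.⋀ ↑x ≈D x
      ⋀↑x≈x = D.antisym (D.⋀-lb ↑x D.refl) (D.⋀-greatest ↑x x (λ x≤z → x≤z))

  ℓ : E.Carrier → D.Carrier
  ℓ y = D.⋀ (λ d → y ≤E h d)

  r : E.Carrier → D.Carrier
  r y = D.⋁ (λ d → h d ≤E y)

  ℓ-lower : ∀ {y d} → y ≤E h d → ℓ y ≤D d
  ℓ-lower = D.⋀-lb _

  r-upper : ∀ {y d} → h d ≤E y → d ≤D r y
  r-upper = D.⋁-ub _

  -- Both adjoints are sections of h; the inequalities ≤ resp. ≥ need surjectivity.
  h-ℓ : ∀ y → h (ℓ y) ≈E y
  h-ℓ y = E.antisym (E.trans (H.⋀-lb _ (E.reflexive (E.Eq.sym hx≈y))) (E.reflexive hx≈y))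
                    (H.⋀-greatest _ y (λ y≤hd → y≤hd))
    where
      hx≈y : h (proj₁ (surjective y)) ≈E y
      hx≈y = proj₂ (surjective y)

  h-r : ∀ y → h (r y) ≈E y
  h-r y = E.antisym (H.⋁-least _ y (λ hd≤y → hd≤y))
                    (E.trans (E.reflexive (E.Eq.sym hx≈y)) (H.⋁-ub _ (E.reflexive hx≈y)))
    where
      hx≈y : h (proj₁ (surjective y)) ≈E y
      hx≈y = proj₂ (surjective y)

  -- r ∘ h is inflationary; it is the closure used to prune in D.
  r∘h-inflationary : ∀ d → d ≤D r (h d)
  r∘h-inflationary _ = r-upper E.refl

  ℓ-lower⁻ : ∀ {y d} → ℓ y ≤D d → y ≤E h d
  ℓ-lower⁻ {y} ℓy≤d = E.trans (E.reflexive (E.Eq.sym (h-ℓ y))) (monotone ℓy≤d)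

  ℓ≤r⇒≤ : ∀ {p x} → ℓ p ≤D r x → p ≤E x
  ℓ≤r⇒≤ {x = x} ℓp≤rx = E.trans (ℓ-lower⁻ ℓp≤rx) (E.reflexive (h-r x))

  -- ℓ maps J^∞(E) into J^∞(D): a join ℓ p ≈ ⋁ S is sent by h to
  -- p ≈ ⋁ h[S], so p ≈ h d for some d ∈ S, and then ℓ p ≤ d ≤ ⋁ S ≈ ℓ p.
  ℓ-CJI : ∀ p → CJI E p → CJI D (ℓ p)
  ℓ-CJI p pCJI S ℓp≈⋁S = fromImage (pCJI image p≈⋁image)
    where
      image : Pred E.Carrier c
      image y = ∃ λ d → S d × (h d ≈E y)
      h⋁S≈⋁image : h (D.⋁ S) ≈E E.⋁ image
      h⋁S≈⋁image = E.antisym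
        (H.⋁-least S _ (λ d∈S → E.⋁-ub image (_ , d∈S , E.Eq.refl)))
        (E.⋁-least image _ (λ { (d , d∈S , hd≈y) →
           E.trans (E.reflexive (E.Eq.sym hd≈y)) (H.⋁-ub S d∈S) }))
      p≈⋁image : p ≈E E.⋁ image
      p≈⋁image = E.Eq.trans (E.Eq.sym (h-ℓ p)) (E.Eq.trans (H.cong ℓp≈⋁S) h⋁S≈⋁image)
      fromImage : (∃ λ y → image y × y ≈E p) → ∃ λ d → S d × d ≈D ℓ p
      fromImage (y , (d , d∈S , hd≈y) , y≈p) = d , d∈S , D.antisym
        (D.trans (D.⋁-ub S d∈S) (D.reflexive (D.Eq.sym ℓp≈⋁S)))
        (ℓ-lower (E.reflexive (E.Eq.sym (E.Eq.trans hd≈y y≈p))))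

  -- h maps r∘h-closed members of M^∞(D) into M^∞(E): a meet h m ≈ ⋀ S is
  -- pulled back to m ≈ ⋀ r[S], so m ≈ r s for some s ∈ S, and h m ≈ h (r s) ≈ s.
  h-CMI : ∀ m → CMI D m → r (h m) ≤D m → CMI E (h m)
  h-CMI m mCMI closed S hm≈⋀S = fromPreimage (mCMI preimage m≈⋀preimage)
    where
      preimage : Pred D.Carrier c
      preimage d = ∃ λ s → S s × (d ≈D r s)
      m≤⋀preimage : m ≤D D.⋀ preimage
      m≤⋀preimage = D.⋀-greatest preimage m (λ { (s , s∈S , d≈rs) →
        D.trans (r-upper (E.trans (E.reflexive hm≈⋀S) (E.⋀-lb S s∈S)))
                (D.reflexive (D.Eq.sym d≈rs)) })
      h⋀preimage≤hm : h (D.⋀ preimage) ≤E h m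
      h⋀preimage≤hm = E.trans
        (E.⋀-greatest S _ (λ {s} s∈S →
           E.trans (H.⋀-lb preimage (s , s∈S , D.Eq.refl)) (E.reflexive (h-r s))))
        (E.reflexive (E.Eq.sym hm≈⋀S))
      m≈⋀preimage : m ≈D D.⋀ preimage
      m≈⋀preimage = D.antisym m≤⋀preimage (D.trans (r-upper h⋀preimage≤hm) closed)
      fromPreimage : (∃ λ d → preimage d × d ≈D m) → ∃ λ s → S s × s ≈E h m
      fromPreimage (d , (s , s∈S , d≈rs) , d≈m) = s , s∈S ,
        E.Eq.trans (E.Eq.sym (h-r s)) (H.cong (D.Eq.trans (D.Eq.sym d≈rs) d≈m))

  -- A description of D ∖ ↑(ℓ p) by members of M^∞(D) yields one of E ∖ ↑p by
  -- members of M^∞(E): prune it to r∘h-closed members and apply h.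
  transferDescription : ∀ p (M : List D.Carrier) → All (CMI D) M → ComplementOfUp D (ℓ p) M →
    ∃ λ N → All (CMI E) N × ComplementOfUp E p N
  transferDescription p M M-CMI M-describes =
    tabulate (h ∘ kept) , Allₚ.tabulate⁺ (λ j → h-CMI _ (CMI-member (select j)) (closed j)) , describes
    where
      member : Fin (length M) → D.Carrier
      member = lookup M
      CMI-member : ∀ i → CMI D (member i)
      CMI-member i = All.lookup M-CMI (∈-lookup i)
      notAbove : ∀ i → ¬ (ℓ p ≤D member i)
      notAbove i = proj₂ (M-describes (member i)) (Any.map (λ { refl → D.refl }) (∈-lookup i))
      below : ∀ d → ¬ (ℓ p ≤D d) → ∃ λ i → d ≤D member i
      below d ℓp≰d = let below-M = proj₁ (M-describes d) ℓp≰d in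
        Any.index below-M , Anyₚ.lookup-index below-M
      -- r∘h cannot push an element of D ∖ ↑(ℓ p) above ℓ p, so M is saturated.
      saturated : Pruning.Saturated D.preorder (r ∘ h) r∘h-inflationary member
      saturated i = below (r (h (member i)))
        (λ ℓp≤rhm → notAbove i (ℓ-lower (ℓ≤r⇒≤ ℓp≤rhm)))
      open Pruning.Pruned (Pruning.prune D.preorder (r ∘ h) r∘h-inflationary
                             (length M) member saturated)
      kept : Fin size → D.Carrier
      kept = member ∘ select
      describes : ComplementOfUp E p (tabulate (h ∘ kept))
      describes x = outside , inside
        where
          outside : ¬ (p ≤E x) → Any (x ≤E_) (tabulate (h ∘ kept))
          outside p≰x with below (r x) (p≰x ∘ ℓ≤r⇒≤)
          ... | i , rx≤i with dominates i
          ...   | j , i≤j = Anyₚ.tabulate⁺ j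
                  (E.trans (E.reflexive (E.Eq.sym (h-r x))) (monotone (D.trans rx≤i i≤j)))
          inside : Any (x ≤E_) (tabulate (h ∘ kept)) → ¬ (p ≤E x)
          inside below-kept p≤x with Anyₚ.tabulate⁻ below-kept
          ... | j , x≤hj = notAbove (select j) (ℓ-lower (E.trans p≤x x≤hj))

  star : Star D → Star E
  star starD p pCJI with starD (ℓ p) (ℓ-CJI p pCJI)
  ... | M , M-CMI , M-describes = transferDescription p M M-CMI M-describes

-- The order dual of a complete lattice; (★) for dual C is exactly (★)^∂ for C.
dual : ∀ {c ℓ₁ ℓ₂ s} → CompleteLattice c ℓ₁ ℓ₂ s → CompleteLattice c ℓ₁ ℓ₂ s
dual C = record
  { poset = record
    { Carrier = Carrier ; _≈_ = _≈_ ; _≤_ = λ x y → y ≤ x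
    ; isPartialOrder = record
      { isPreorder = record
        { isEquivalence = isEquivalence
        ; reflexive = λ x≈y → reflexive (Eq.sym x≈y)
        ; trans = λ y≤x z≤y → trans z≤y y≤x }
      ; antisym = λ y≤x x≤y → antisym x≤y y≤x } }
  ; ⋁ = ⋀ ; ⋁-ub = ⋀-lb ; ⋁-least = ⋀-greatest
  ; ⋀ = ⋁ ; ⋀-lb = ⋁-ub ; ⋀-greatest = ⋁-least }
  where open CompleteLattice C

dualHom : ∀ {c₁ ℓ₁ ℓ₁' s₁ c₂ ℓ₂ ℓ₂' s₂}
  {D : CompleteLattice c₁ ℓ₁ ℓ₁' s₁} {E : CompleteLattice c₂ ℓ₂ ℓ₂' s₂} {h} →
  IsCompleteHom D E h → IsCompleteHom (dual D) (dual E) h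
dualHom hom = record
  { cong = cong ; ⋁-ub = ⋀-lb ; ⋁-least = ⋀-greatest ; ⋀-lb = ⋁-ub ; ⋀-greatest = ⋁-least }
  where open IsCompleteHom hom

lemma4 : ∀ {c} (D : CompleteLattice c c c c) (E : CompleteLattice c c c c)
    (h : CompleteLattice.Carrier D → CompleteLattice.Carrier E) →
    IsCompleteHom D E h → Surjective D E h →
    (Star D → Star E) × (StarDual D → StarDual E)
lemma4 D E h hom surjective =
  SurjectiveHom.star D E h hom surjective ,
  SurjectiveHom.star (dual D) (dual E) h (dualHom hom) surjective
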